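{- Let $\sigma\in A^s$ and let $\sigma'$ be a permutation of $\sigma$. Then for each $\sigma$-normal form $P_\sigma$ there is a $\sigma'$-normal form $Q_{\sigma'}$ such that $\mathrm{EqC\ell FEL}_2\vdash P_\sigma=Q_{\sigma'}$.
   Context: $A$ is a countable set of atoms; $A^s$ is the set of finite strings over $A$ with no atom occurring more than once. Terms are built from $\mathsf T,\mathsf F$, atoms, $\neg$, $\mathbin{\wedge_\bullet}$, $\mathbin{\vee_\bullet}$. $\sigma$-normal forms: for $\sigma=\epsilon$ they are $\mathsf T$ and $\mathsf F$; for $\sigma=a\rho$ ($a\in A$) they are the terms $(a\mathbin{\wedge_\bullet}P_1)\mathbin{\vee_\bullet}(\neg a\mathbin{\wedge_\bullet}P_2)$ with $P_1,P_2$ $\rho$-normal forms. $\mathrm{EqC\ell FEL}_2$ consists of: $\mathsf F=\neg\mathsf T$; $x\mathbin{\vee_\bullet}y=\neg(\neg x\mathbin{\wedge_\bullet}\neg y)$; $\neg\neg x=x$; $(x\mathbin{\wedge_\bullet}y)\mathbin{\wedge_\bullet}z=x\mathbin{\wedge_\bullet}(y\mathbin{\wedge_\bullet}z)$; $\mathsf T\mathbin{\wedge_\bullet}x=x$; $x\mathbin{\wedge_\bullet}\mathsf T=x$; $x\mathbin{\wedge_\bullet}\mathsf F=\mathsf F\mathbin{\wedge_\bullet}x$; $\neg x\mathbin{\wedge_\bullet}\mathsf F=x\mathbin{\wedge_\bullet}\mathsf F$; $(x\mathbin{\wedge_\bullet}\mathsf F)\mathbin{\vee_\bullet}y=(x\mathbin{\vee_\bullet}\mathsf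 T)\mathbin{\wedge_\bullet}y$; $x\mathbin{\vee_\bullet}(y\mathbin{\wedge_\bullet}\mathsf F)=x\mathbin{\wedge_\bullet}(y\mathbin{\vee_\bullet}\mathsf T)$; $(x\mathbin{\vee_\bullet}y)\mathbin{\wedge_\bullet}z=(\neg x\mathbin{\wedge_\bullet}(y\mathbin{\wedge_\bullet}z))\mathbin{\vee_\bullet}(x\mathbin{\wedge_\bullet}z)$; $x\mathbin{\wedge_\bullet}y=y\mathbin{\wedge_\bullet}x$. $\vdash$ is derivability in equational logic. -}

module Defs where

open import Data.Nat using (ℕ)
open import Data.List using (List; []; _∷_)

Atom : Set
Atom = ℕ

-- Terms over T, F, atoms, ¬, left-sequential ∧, left-sequential ∨.
infixr 6 _∧●_
infixr 5 _∨●_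
data Term : Set where
  𝐓 𝐅  : Term
  atom : Atom → Term
  ¬′   : Term → Term
  _∧●_ : Term → Term → Term
  _∨●_ : Term → Term → Term

data NF : List Atom → Term → Set where
  nf-T : NF [] 𝐓
  nf-F : NF [] 𝐅
  nf-a : ∀ {a ρ P₁ P₂} → NF ρ P₁ → NF ρ P₂ →
         NF (a ∷ ρ) ((atom a ∧● P₁) ∨● (¬′ (atom a) ∧● P₂))

-- Derivability in equational logic from EqCℓFEL₂.
-- Axioms are given as schemata (all substitution instances), closed under
-- reflexivity, symmetry, transitivity and congruence.
infix 4 _⊢≈_
data _⊢≈_ : Term → Term → Set where
  ax-F    : 𝐅 ⊢≈ ¬′ 𝐓
  ax-or   : ∀ x y → x ∨● y ⊢≈ ¬′ (¬′ x ∧● ¬′ y)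
  ax-nn   : ∀ x → ¬′ (¬′ x) ⊢≈ x
  ax-assoc : ∀ x y z → (x ∧● y) ∧● z ⊢≈ x ∧● (y ∧● z)
  ax-Tl   : ∀ x → 𝐓 ∧● x ⊢≈ x
  ax-Tr   : ∀ x → x ∧● 𝐓 ⊢≈ x
  ax-F1   : ∀ x → x ∧● 𝐅 ⊢≈ 𝐅 ∧● x
  ax-F2   : ∀ x → ¬′ x ∧● 𝐅 ⊢≈ x ∧● 𝐅
  ax-F3   : ∀ x y → (x ∧● 𝐅) ∨● y ⊢≈ (x ∨● 𝐓) ∧● y
  ax-F4   : ∀ x y → x ∨● (y ∧● 𝐅) ⊢≈ x ∧● (y ∨● 𝐓)
  ax-dist : ∀ x y z → (x ∨● y) ∧● z ⊢≈ (¬′ x ∧● (y ∧● z)) ∨● (x ∧● z)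
  ax-comm : ∀ x y → x ∧● y ⊢≈ y ∧● x
  refl′  : ∀ {x} → x ⊢≈ x
  sym′   : ∀ {x y} → x ⊢≈ y → y ⊢≈ x
  trans′ : ∀ {x y z} → x ⊢≈ y → y ⊢≈ z → x ⊢≈ z
  cong-¬ : ∀ {x x′} → x ⊢≈ x′ → ¬′ x ⊢≈ ¬′ x′
  cong-∧ : ∀ {x x′ y y′} → x ⊢≈ x′ → y ⊢≈ y′ → x ∧● y ⊢≈ x′ ∧● y′
  cong-∨ : ∀ {x x′ y y′} → x ⊢≈ x′ → y ⊢≈ y′ → x ∨● y ⊢≈ x′ ∨● y′

-- Both ∧● (by the axioms) and ∨● (by De Morgan duality) are commutative and
-- associative, and from the axioms on 𝐓 and 𝐅 one derives that ∧● distributes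
-- over ∨● from either side.  A (aρ)-normal form is the conditional
-- (a ∧● P₁) ∨● (¬a ∧● P₂); distributing out two nested conditionals on a and b
-- gives four guarded disjuncts which can be reordered to nest them the other
-- way round.  As permutations are generated by adjacent swaps, the normal form
-- can be carried along any permutation of σ.
module Submission where

open import Defs
open import Level using (0ℓ)
open import Data.Product using (Σ; _×_; _,_)
open import Data.List using (List; _∷_)
open import Data.List.Relation.Unary.Unique.Propositional using (Unique)
open import Data.List.Relation.Binary.Permutation.Propositional using (_↭_; refl; prep; swap; trans)
open import Relation.Binary.Bundles using (Setoid)
open import Relation.Binary.Structures using (IsEquivalence)
open import Algebra.Bundles using (CommutativeSemigroup)
import Algebra.Properties.CommutativeSemigroup as CommutativeSemigroupProperties

⊢≈-isEquivalence : IsEquivalence _⊢≈_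
⊢≈-isEquivalence = record { refl = refl′ ; sym = sym′ ; trans = trans′ }

⊢≈-setoid : Setoid 0ℓ 0ℓ
⊢≈-setoid = record { isEquivalence = ⊢≈-isEquivalence }

open import Relation.Binary.Reasoning.Setoid ⊢≈-setoid

∧-congˡ : ∀ {x y y′} → y ⊢≈ y′ → x ∧● y ⊢≈ x ∧● y′
∧-congˡ = cong-∧ refl′

∧-congʳ : ∀ {x x′ y} → x ⊢≈ x′ → x ∧● y ⊢≈ x′ ∧● y
∧-congʳ p = cong-∧ p refl′

∨-congʳ : ∀ {x x′ y} → x ⊢≈ x′ → x ∨● y ⊢≈ x′ ∨● y
∨-congʳ p = cong-∨ p refl′

∧-commutativeSemigroup : CommutativeSemigroup 0ℓ 0ℓ
∧-commutativeSemigroup = record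
  { _∙_ = _∧●_
  ; isCommutativeSemigroup = record
    { isSemigroup = record
      { isMagma = record { isEquivalence = ⊢≈-isEquivalence ; ∙-cong = cong-∧ }
      ; assoc = ax-assoc
      }
    ; comm = ax-comm
    }
  }

module ∧ = CommutativeSemigroupProperties ∧-commutativeSemigroup

deMorgan₁ : ∀ x y → ¬′ (x ∧● y) ⊢≈ ¬′ x ∨● ¬′ y
deMorgan₁ x y = begin
  ¬′ (x ∧● y)                 ≈⟨ cong-¬ (cong-∧ (ax-nn x) (ax-nn y)) ⟨
  ¬′ (¬′ (¬′ x) ∧● ¬′ (¬′ y)) ≈⟨ ax-or (¬′ x) (¬′ y) ⟨
  ¬′ x ∨● ¬′ y                ∎

deMorgan₂ : ∀ x y → ¬′ (x ∨● y) ⊢≈ ¬′ x ∧● ¬′ y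
deMorgan₂ x y = trans′ (cong-¬ (ax-or x y)) (ax-nn _)

∨-comm : ∀ x y → x ∨● y ⊢≈ y ∨● x
∨-comm x y = begin
  x ∨● y            ≈⟨ ax-or x y ⟩
  ¬′ (¬′ x ∧● ¬′ y) ≈⟨ cong-¬ (ax-comm _ _) ⟩
  ¬′ (¬′ y ∧● ¬′ x) ≈⟨ ax-or y x ⟨
  y ∨● x            ∎

∨-assoc : ∀ x y z → (x ∨● y) ∨● z ⊢≈ x ∨● (y ∨● z)
∨-assoc x y z = begin
  (x ∨● y) ∨● z                ≈⟨ ax-or _ _ ⟩
  ¬′ (¬′ (x ∨● y) ∧● ¬′ z)     ≈⟨ cong-¬ (∧-congʳ (deMorgan₂ x y)) ⟩
  ¬′ ((¬′ x ∧● ¬′ y) ∧● ¬′ z)  ≈⟨ cong-¬ (ax-assoc _ _ _) ⟩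
  ¬′ (¬′ x ∧● (¬′ y ∧● ¬′ z))  ≈⟨ cong-¬ (∧-congˡ (deMorgan₂ y z)) ⟨
  ¬′ (¬′ x ∧● ¬′ (y ∨● z))     ≈⟨ ax-or _ _ ⟨
  x ∨● (y ∨● z)                ∎

∨-commutativeSemigroup : CommutativeSemigroup 0ℓ 0ℓ
∨-commutativeSemigroup = record
  { _∙_ = _∨●_
  ; isCommutativeSemigroup = record
    { isSemigroup = record
      { isMagma = record { isEquivalence = ⊢≈-isEquivalence ; ∙-cong = cong-∨ }
      ; assoc = ∨-assoc
      }
    ; comm = ∨-comm
    }
  }

module ∨ = CommutativeSemigroupProperties ∨-commutativeSemigroup

¬𝐅≈𝐓 : ¬′ 𝐅 ⊢≈ 𝐓
¬𝐅≈𝐓 = trans′ (cong-¬ ax-F) (ax-nn 𝐓)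

x∨𝐅≈x : ∀ x → x ∨● 𝐅 ⊢≈ x
x∨𝐅≈x x = begin
  x ∨● 𝐅            ≈⟨ ax-or x 𝐅 ⟩
  ¬′ (¬′ x ∧● ¬′ 𝐅) ≈⟨ cong-¬ (∧-congˡ ¬𝐅≈𝐓) ⟩
  ¬′ (¬′ x ∧● 𝐓)    ≈⟨ cong-¬ (ax-Tr _) ⟩
  ¬′ (¬′ x)         ≈⟨ ax-nn x ⟩
  x                 ∎

x∨𝐓≈¬[x∧𝐅] : ∀ x → x ∨● 𝐓 ⊢≈ ¬′ (x ∧● 𝐅)
x∨𝐓≈¬[x∧𝐅] x = begin
  x ∨● 𝐓            ≈⟨ ax-or x 𝐓 ⟩
  ¬′ (¬′ x ∧● ¬′ 𝐓) ≈⟨ cong-¬ (∧-congˡ ax-F) ⟨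
  ¬′ (¬′ x ∧● 𝐅)    ≈⟨ cong-¬ (ax-F2 x) ⟩
  ¬′ (x ∧● 𝐅)       ∎

¬x∨𝐓≈x∨𝐓 : ∀ x → ¬′ x ∨● 𝐓 ⊢≈ x ∨● 𝐓
¬x∨𝐓≈x∨𝐓 x = begin
  ¬′ x ∨● 𝐓        ≈⟨ x∨𝐓≈¬[x∧𝐅] (¬′ x) ⟩
  ¬′ (¬′ x ∧● 𝐅)   ≈⟨ cong-¬ (ax-F2 x) ⟩
  ¬′ (x ∧● 𝐅)      ≈⟨ x∨𝐓≈¬[x∧𝐅] x ⟨
  x ∨● 𝐓           ∎

x∨y≈[¬x∧y]∨x : ∀ x y → x ∨● y ⊢≈ (¬′ x ∧● y) ∨● x
x∨y≈[¬x∧y]∨x x y = begin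
  x ∨● y                          ≈⟨ ax-Tr _ ⟨
  (x ∨● y) ∧● 𝐓                   ≈⟨ ax-dist x y 𝐓 ⟩
  (¬′ x ∧● (y ∧● 𝐓)) ∨● (x ∧● 𝐓)  ≈⟨ cong-∨ (∧-congˡ (ax-Tr y)) (ax-Tr x) ⟩
  (¬′ x ∧● y) ∨● x                ∎

x∧y≈[¬x∨y]∧x : ∀ x y → x ∧● y ⊢≈ (¬′ x ∨● y) ∧● x
x∧y≈[¬x∨y]∧x x y = begin
  x ∧● y                              ≈⟨ ax-nn _ ⟨
  ¬′ (¬′ (x ∧● y))                    ≈⟨ cong-¬ (deMorgan₁ x y) ⟩
  ¬′ (¬′ x ∨● ¬′ y)                   ≈⟨ cong-¬ (x∨y≈[¬x∧y]∨x (¬′ x) (¬′ y)) ⟩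
  ¬′ ((¬′ (¬′ x) ∧● ¬′ y) ∨● ¬′ x)    ≈⟨ deMorgan₂ _ _ ⟩
  ¬′ (¬′ (¬′ x) ∧● ¬′ y) ∧● ¬′ (¬′ x) ≈⟨ cong-∧ (cong-¬ (∧-congʳ (ax-nn x))) (ax-nn x) ⟩
  ¬′ (x ∧● ¬′ y) ∧● x                 ≈⟨ ∧-congʳ (deMorgan₁ x (¬′ y)) ⟩
  (¬′ x ∨● ¬′ (¬′ y)) ∧● x            ≈⟨ ∧-congʳ (cong-∨ refl′ (ax-nn y)) ⟩
  (¬′ x ∨● y) ∧● x                    ∎

x∨𝐓≈¬x∨x : ∀ x → x ∨● 𝐓 ⊢≈ ¬′ x ∨● x
x∨𝐓≈¬x∨x x = trans′ (x∨y≈[¬x∧y]∨x x 𝐓) (∨-congʳ (ax-Tr _))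

[x∨𝐓]∧x≈x : ∀ x → (x ∨● 𝐓) ∧● x ⊢≈ x
[x∨𝐓]∧x≈x x = begin
  (x ∨● 𝐓) ∧● x                  ≈⟨ ∧-congʳ (¬x∨𝐓≈x∨𝐓 x) ⟨
  (¬′ x ∨● 𝐓) ∧● x               ≈⟨ ax-F3 (¬′ x) x ⟨
  (¬′ x ∧● 𝐅) ∨● x               ≈⟨ cong-∨ (∧-congˡ (ax-Tr 𝐅)) (ax-Tr x) ⟨
  (¬′ x ∧● (𝐅 ∧● 𝐓)) ∨● (x ∧● 𝐓) ≈⟨ ax-dist x 𝐅 𝐓 ⟨
  (x ∨● 𝐅) ∧● 𝐓                  ≈⟨ ax-Tr _ ⟩
  x ∨● 𝐅                         ≈⟨ x∨𝐅≈x x ⟩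
  x                              ∎

[x∨𝐓]∧¬x≈¬x : ∀ x → (x ∨● 𝐓) ∧● ¬′ x ⊢≈ ¬′ x
[x∨𝐓]∧¬x≈¬x x = trans′ (∧-congʳ (sym′ (¬x∨𝐓≈x∨𝐓 x))) ([x∨𝐓]∧x≈x (¬′ x))

∧-idem : ∀ x → x ∧● x ⊢≈ x
∧-idem x = begin
  x ∧● x            ≈⟨ x∧y≈[¬x∨y]∧x x x ⟩
  (¬′ x ∨● x) ∧● x  ≈⟨ ∧-congʳ (x∨𝐓≈¬x∨x x) ⟨
  (x ∨● 𝐓) ∧● x     ≈⟨ [x∨𝐓]∧x≈x x ⟩
  x                 ∎

∨-idem : ∀ x → x ∨● x ⊢≈ x
∨-idem x = trans′ (ax-or x x) (trans′ (cong-¬ (∧-idem _)) (ax-nn x))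

x∧𝐅≈¬x∧x : ∀ x → x ∧● 𝐅 ⊢≈ ¬′ x ∧● x
x∧𝐅≈¬x∧x x = begin
  x ∧● 𝐅                                  ≈⟨ x∧y≈[¬x∨y]∧x x 𝐅 ⟩
  (¬′ x ∨● 𝐅) ∧● x                        ≈⟨ ax-dist (¬′ x) 𝐅 x ⟩
  (¬′ (¬′ x) ∧● (𝐅 ∧● x)) ∨● (¬′ x ∧● x)  ≈⟨ ∨-congʳ (cong-∧ (ax-nn x) (ax-comm 𝐅 x)) ⟩
  (x ∧● (x ∧● 𝐅)) ∨● (¬′ x ∧● x)          ≈⟨ ∨-congʳ (ax-assoc _ _ _) ⟨
  ((x ∧● x) ∧● 𝐅) ∨● (¬′ x ∧● x)          ≈⟨ ∨-congʳ (∧-congʳ (∧-idem x)) ⟩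
  (x ∧● 𝐅) ∨● (¬′ x ∧● x)                 ≈⟨ ax-F3 x _ ⟩
  (x ∨● 𝐓) ∧● (¬′ x ∧● x)                 ≈⟨ ax-assoc _ _ _ ⟨
  ((x ∨● 𝐓) ∧● ¬′ x) ∧● x                 ≈⟨ ∧-congʳ ([x∨𝐓]∧¬x≈¬x x) ⟩
  ¬′ x ∧● x                               ∎

[x∨𝐓]∧𝐅≈x∧𝐅 : ∀ x → (x ∨● 𝐓) ∧● 𝐅 ⊢≈ x ∧● 𝐅
[x∨𝐓]∧𝐅≈x∧𝐅 x = begin
  (x ∨● 𝐓) ∧● 𝐅                   ≈⟨ ax-dist x 𝐓 𝐅 ⟩
  (¬′ x ∧● (𝐓 ∧● 𝐅)) ∨● (x ∧● 𝐅)  ≈⟨ ∨-congʳ (∧-congˡ (ax-Tl 𝐅)) ⟩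
  (¬′ x ∧● 𝐅) ∨● (x ∧● 𝐅)         ≈⟨ ∨-congʳ (ax-F2 x) ⟩
  (x ∧● 𝐅) ∨● (x ∧● 𝐅)            ≈⟨ ∨-idem _ ⟩
  x ∧● 𝐅                          ∎

[x∨𝐓]∧[y∨𝐓]≈[x∧y]∨𝐓 : ∀ x y → (x ∨● 𝐓) ∧● (y ∨● 𝐓) ⊢≈ (x ∧● y) ∨● 𝐓
[x∨𝐓]∧[y∨𝐓]≈[x∧y]∨𝐓 x y = begin
  (x ∨● 𝐓) ∧● (y ∨● 𝐓)         ≈⟨ ax-F3 x _ ⟨
  (x ∧● 𝐅) ∨● (y ∨● 𝐓)         ≈⟨ ∨-assoc _ _ _ ⟨
  ((x ∧● 𝐅) ∨● y) ∨● 𝐓         ≈⟨ ∨-congʳ (ax-F3 x y) ⟩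
  ((x ∨● 𝐓) ∧● y) ∨● 𝐓         ≈⟨ x∨𝐓≈¬[x∧𝐅] _ ⟩
  ¬′ (((x ∨● 𝐓) ∧● y) ∧● 𝐅)    ≈⟨ cong-¬ (∧.xy∙z≈xz∙y _ y 𝐅) ⟩
  ¬′ (((x ∨● 𝐓) ∧● 𝐅) ∧● y)    ≈⟨ cong-¬ (∧-congʳ ([x∨𝐓]∧𝐅≈x∧𝐅 x)) ⟩
  ¬′ ((x ∧● 𝐅) ∧● y)           ≈⟨ cong-¬ (∧.xy∙z≈xz∙y x 𝐅 y) ⟩
  ¬′ ((x ∧● y) ∧● 𝐅)           ≈⟨ x∨𝐓≈¬[x∧𝐅] _ ⟨
  (x ∧● y) ∨● 𝐓                ∎

-- Once x has been evaluated inside w = z ∧● x, the ¬x-disjunct of ¬(y ∧● x)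
-- can only fail: ¬x ∧● w is the contradiction w ∧● 𝐅.
¬[y∧x]∧[z∧x]≈¬y∧[z∧x] : ∀ x y z → ¬′ (y ∧● x) ∧● (z ∧● x) ⊢≈ ¬′ y ∧● (z ∧● x)
¬[y∧x]∧[z∧x]≈¬y∧[z∧x] x y z = begin
  ¬′ (y ∧● x) ∧● w                              ≈⟨ ∧-congʳ (deMorgan₁ y x) ⟩
  (¬′ y ∨● ¬′ x) ∧● w                           ≈⟨ ax-dist _ _ _ ⟩
  (¬′ (¬′ y) ∧● (¬′ x ∧● w)) ∨● (¬′ y ∧● w)     ≈⟨ ∨-congʳ (cong-∧ (ax-nn y) ¬x∧w≈w∧𝐅) ⟩
  (y ∧● (w ∧● 𝐅)) ∨● (¬′ y ∧● w)                ≈⟨ ∨-congʳ (ax-assoc _ _ _) ⟨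
  ((y ∧● w) ∧● 𝐅) ∨● (¬′ y ∧● w)                ≈⟨ ax-F3 _ _ ⟩
  ((y ∧● w) ∨● 𝐓) ∧● (¬′ y ∧● w)                ≈⟨ ∧-congʳ ([x∨𝐓]∧[y∨𝐓]≈[x∧y]∨𝐓 y w) ⟨
  ((y ∨● 𝐓) ∧● (w ∨● 𝐓)) ∧● (¬′ y ∧● w)         ≈⟨ ∧.interchange _ _ _ _ ⟩
  ((y ∨● 𝐓) ∧● ¬′ y) ∧● ((w ∨● 𝐓) ∧● w)         ≈⟨ cong-∧ ([x∨𝐓]∧¬x≈¬x y) ([x∨𝐓]∧x≈x w) ⟩
  ¬′ y ∧● w                                     ∎
  where
  w : Term
  w = z ∧● x

  ¬x∧w≈w∧𝐅 : ¬′ x ∧● w ⊢≈ w ∧● 𝐅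
  ¬x∧w≈w∧𝐅 = begin
    ¬′ x ∧● (z ∧● x)  ≈⟨ ∧.x∙yz≈y∙xz _ _ _ ⟩
    z ∧● (¬′ x ∧● x)  ≈⟨ ∧-congˡ (x∧𝐅≈¬x∧x x) ⟨
    z ∧● (x ∧● 𝐅)     ≈⟨ ax-assoc _ _ _ ⟨
    (z ∧● x) ∧● 𝐅     ∎

∧-distribʳ-∨ : ∀ x y z → (y ∨● z) ∧● x ⊢≈ (y ∧● x) ∨● (z ∧● x)
∧-distribʳ-∨ x y z = begin
  (y ∨● z) ∧● x                          ≈⟨ ax-dist y z x ⟩
  (¬′ y ∧● (z ∧● x)) ∨● (y ∧● x)         ≈⟨ ∨-congʳ (¬[y∧x]∧[z∧x]≈¬y∧[z∧x] x y z) ⟨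
  (¬′ (y ∧● x) ∧● (z ∧● x)) ∨● (y ∧● x)  ≈⟨ x∨y≈[¬x∧y]∨x (y ∧● x) (z ∧● x) ⟨
  (y ∧● x) ∨● (z ∧● x)                   ∎

∧-distribˡ-∨ : ∀ x y z → x ∧● (y ∨● z) ⊢≈ (x ∧● y) ∨● (x ∧● z)
∧-distribˡ-∨ x y z = begin
  x ∧● (y ∨● z)         ≈⟨ ax-comm _ _ ⟩
  (y ∨● z) ∧● x         ≈⟨ ∧-distribʳ-∨ x y z ⟩
  (y ∧● x) ∨● (z ∧● x)  ≈⟨ cong-∨ (ax-comm _ _) (ax-comm _ _) ⟩
  (x ∧● y) ∨● (x ∧● z)  ∎

cond : Term → Term → Term → Term
cond x p q = (x ∧● p) ∨● (¬′ x ∧● q)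

cond-cong : ∀ x {p p′ q q′} → p ⊢≈ p′ → q ⊢≈ q′ → cond x p q ⊢≈ cond x p′ q′
cond-cong x p≈p′ q≈q′ = cong-∨ (∧-congˡ p≈p′) (∧-congˡ q≈q′)

cond-swap : ∀ x y p q r s →
  cond x (cond y p q) (cond y r s) ⊢≈ cond y (cond x p r) (cond x q s)
cond-swap x y p q r s = begin
  cond x (cond y p q) (cond y r s)
    ≈⟨ cong-∨ (∧-distribˡ-∨ _ _ _) (∧-distribˡ-∨ _ _ _) ⟩
  ((x ∧● (y ∧● p)) ∨● (x ∧● (¬′ y ∧● q))) ∨● ((¬′ x ∧● (y ∧● r)) ∨● (¬′ x ∧● (¬′ y ∧● s)))
    ≈⟨ ∨.interchange _ _ _ _ ⟩
  ((x ∧● (y ∧● p)) ∨● (¬′ x ∧● (y ∧● r))) ∨● ((x ∧● (¬′ y ∧● q)) ∨● (¬′ x ∧● (¬′ y ∧● s)))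
    ≈⟨ cong-∨ (cong-∨ (∧.x∙yz≈y∙xz _ _ _) (∧.x∙yz≈y∙xz _ _ _))
              (cong-∨ (∧.x∙yz≈y∙xz _ _ _) (∧.x∙yz≈y∙xz _ _ _)) ⟩
  ((y ∧● (x ∧● p)) ∨● (y ∧● (¬′ x ∧● r))) ∨● ((¬′ y ∧● (x ∧● q)) ∨● (¬′ y ∧● (¬′ x ∧● s)))
    ≈⟨ cong-∨ (∧-distribˡ-∨ _ _ _) (∧-distribˡ-∨ _ _ _) ⟨
  cond y (cond x p r) (cond x q s)
    ∎

HasNF : List Atom → Term → Set
HasNF σ P = Σ Term (λ Q → NF σ Q × (P ⊢≈ Q))

HasNF-resp : ∀ {σ P P′} → P ⊢≈ P′ → HasNF σ P′ → HasNF σ P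
HasNF-resp P≈P′ (Q , nfQ , P′≈Q) = Q , nfQ , trans′ P≈P′ P′≈Q

HasNF-cond : ∀ {a ρ P₁ P₂} → HasNF ρ P₁ → HasNF ρ P₂ → HasNF (a ∷ ρ) (cond (atom a) P₁ P₂)
HasNF-cond {a} (Q₁ , nf₁ , P₁≈Q₁) (Q₂ , nf₂ , P₂≈Q₂) =
  cond (atom a) Q₁ Q₂ , nf-a nf₁ nf₂ , cond-cong (atom a) P₁≈Q₁ P₂≈Q₂

NF-↭ : ∀ {σ σ′ P} → σ ↭ σ′ → NF σ P → HasNF σ′ P
NF-↭ refl nfP = _ , nfP , refl′
NF-↭ (prep a σ↭σ′) (nf-a nf₁ nf₂) = HasNF-cond (NF-↭ σ↭σ′ nf₁) (NF-↭ σ↭σ′ nf₂)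
NF-↭ (swap a b σ↭σ′) (nf-a (nf-a nf₁ nf₂) (nf-a nf₃ nf₄)) =
  HasNF-resp (cond-swap (atom a) (atom b) _ _ _ _)
    (HasNF-cond (HasNF-cond (NF-↭ σ↭σ′ nf₁) (NF-↭ σ↭σ′ nf₃))
                (HasNF-cond (NF-↭ σ↭σ′ nf₂) (NF-↭ σ↭σ′ nf₄)))
NF-↭ (trans σ↭σ′ σ′↭σ″) nfP with NF-↭ σ↭σ′ nfP
... | Q , nfQ , P≈Q = HasNF-resp P≈Q (NF-↭ σ′↭σ″ nfQ)

lemma6p9 : (σ σ′ : List Atom) → Unique σ → σ ↭ σ′ →
    (P : Term) → NF σ P → Σ Term (λ Q → NF σ′ Q × (P ⊢≈ Q))
lemma6p9 _ _ _ σ↭σ′ _ = NF-↭ σ↭σ′
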